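{- Let $A$ be a finite set of atoms, $P$ a propositional Horn theory over $A$ and $I\subseteq A$ an interpretation (regarded as the theory of facts $a$, $a\in I$). Then $P\circ I=I\circ P$ if and only if $I$ is a supported model of $P$, i.e. $T_P(I)=I$.
   Context: A theory over $A$ is a finite set of rules $a_0\leftarrow a_1,\ldots,a_k$ ($k\ge0$, $a_i\in A$), with $head(r)=\{a_0\}$, $body(r)=\{a_1,\ldots,a_k\}$, size $k$; $head(S),body(S)$ are unions over a set $S$ of rules. A fact is a rule with empty body. Write $S\subseteq_r R$ if $S\subseteq R$ has as many elements as the size of $r$. Composition: $P\circ R=\{head(r)\leftarrow body(S)\mid r\in P,\ S\subseteq_r R,\ head(S)=body(r)\}$. The van Emden–Kowalski operator is $T_P(I)=\bigcup\{head(r)\mid r\in P,\ body(r)\subseteq I\}$; a supported model of $P$ is a fixed point of $T_P$. -}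

module Defs where

open import Data.Nat using (ℕ)
open import Data.Fin using (Fin)
open import Data.Fin.Subset using (Subset; ⊥; ⁅_⁆; _∪_; _⊆_; ∣_∣) renaming (_∈_ to _∈ₛ_)
open import Data.Fin.Subset.Properties using (_⊆?_)
open import Data.List using (List; []; _∷_; foldr; length)
open import Data.List.Membership.Propositional using (_∈_)
open import Data.List.Relation.Unary.All using (All)
open import Data.List.Relation.Unary.Unique.Propositional using (Unique)
open import Data.Product using (Σ; _×_; ∃)
open import Relation.Nullary using (yes; no)
open import Relation.Binary.PropositionalEquality using (_≡_)
open import Level using (0ℓ)
open import Relation.Unary using (Pred)

-- Atoms: the finite set A is Fin n.
-- A rule  a₀ ← a₁,…,aₖ  has a head atom and a body, a (finite) set of atoms.
record Rule (n : ℕ) : Set where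
  constructor _←_
  field
    hd   : Fin n
    body : Subset n
open Rule public

head : ∀ {n} → Rule n → Subset n
head r = ⁅ hd r ⁆

size : ∀ {n} → Rule n → ℕ
size r = ∣ body r ∣

-- A finite set of rules is represented by a list (duplicates irrelevant).
Theory : ℕ → Set
Theory n = List (Rule n)

headS : ∀ {n} → List (Rule n) → Subset n
headS = foldr (λ r acc → head r ∪ acc) ⊥

bodyS : ∀ {n} → List (Rule n) → Subset n
bodyS = foldr (λ r acc → body r ∪ acc) ⊥

-- Sets of rules in general (results of composition) as predicates on rules;
-- since Rule n is finite, every such set is finite.
RuleSet : ℕ → Set₁
RuleSet n = Pred (Rule n) 0ℓ

⟦_⟧ : ∀ {n} → Theory n → RuleSet n
⟦ P ⟧ r = r ∈ P

facts : ∀ {n} → Subset n → RuleSet n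
facts I r = (body r ≡ ⊥) × (hd r ∈ₛ I)

-- S ⊆_r R : S ⊆ R (S a finite set of rules, given as a duplicate-free list)
-- and S has exactly size(r) elements.
_⊆[_]_ : ∀ {n} → List (Rule n) → Rule n → RuleSet n → Set
S ⊆[ r ] R = All R S × Unique S × (length S ≡ size r)

_∘ᵗ_ : ∀ {n} → RuleSet n → RuleSet n → RuleSet n
(P ∘ᵗ R) r' = Σ (Rule _) λ r → P r × Σ (List (Rule _)) λ S →
  S ⊆[ r ] R × (headS S ≡ body r) × (r' ≡ (hd r ← bodyS S))

_≐_ : ∀ {n} → RuleSet n → RuleSet n → Set
P ≐ Q = ∀ r → (P r → Q r) × (Q r → P r)

T : ∀ {n} → Theory n → Subset n → Subset n
T [] I = ⊥
T (r ∷ P) I with body r ⊆? I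
... | yes _ = head r ∪ T P I
... | no  _ = T P I

SupportedModel : ∀ {n} → Theory n → Subset n → Set
SupportedModel P I = T P I ≡ I

module Submission where

open import Defs
open import Data.Nat using (ℕ; suc)
open import Data.Fin.Subset using (Subset)
open import Data.Product using (_×_)

open import Data.Nat.Properties using (1+n≢0)
open import Data.Fin using (Fin; zero; suc)
open import Data.Fin.Properties using (suc-injective)
open import Data.Fin.Subset using (⊥; _∪_; _⊆_; ∣_∣; inside; outside)
  renaming (_∈_ to _∈ₛ_)
open import Data.Fin.Subset.Properties
  using (_⊆?_; ∣⊥∣≡0; ⊆-antisym; ∪-identityˡ; x∈⁅x⁆; x∈⁅y⁆⇒x≡y; x∈p∪q⁻; p⊆p∪q; q⊆p∪q; ∉⊥)
open import Data.Vec using ([]; _∷_; here; there)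
open import Data.List using (List; []; _∷_; map; length)
open import Data.List.Properties using (length-map)
open import Data.List.Membership.Propositional using (_∈_)
open import Data.List.Membership.Propositional.Properties using (∈-map⁺; ∈-map⁻)
open import Data.List.Relation.Unary.All as All using (All; []; _∷_)
open import Data.List.Relation.Unary.Any using (here; there)
open import Data.List.Relation.Unary.AllPairs using ([]; _∷_)
open import Data.List.Relation.Unary.Unique.Propositional using (Unique)
import Data.List.Relation.Unary.Unique.Propositional.Properties as Unique
open import Data.Product using (∃₂; _,_; proj₁; proj₂)
open import Data.Sum using (inj₁; inj₂)
open import Relation.Nullary using (yes; no; contradiction)
open import Relation.Binary.PropositionalEquality
  using (_≡_; _≢_; refl; sym; trans; cong; cong₂; subst; module ≡-Reasoning)

-- Composing with facts on the left is inert: a fact has no body, so it can only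
-- be composed with the empty set of rules, and I ∘ R = I for every R.  On the
-- right, r ∈ P composes with I exactly when body(r) ⊆ I, the chosen facts being
-- those of body(r); so P ∘ I is the set of facts T_P(I).  Hence P ∘ I = I ∘ P
-- says that the facts of T_P(I) and of I coincide, i.e. T_P(I) = I.

fact : ∀ {n} → Fin n → Rule n
fact a = a ← ⊥

module _ {n : ℕ} where

  ≐-reflexive : {P Q : RuleSet n} → P ≡ Q → P ≐ Q
  ≐-reflexive refl r = (λ p → p) , (λ p → p)

  ≐-sym : {P Q : RuleSet n} → P ≐ Q → Q ≐ P
  ≐-sym P≐Q r = proj₂ (P≐Q r) , proj₁ (P≐Q r)

  ≐-trans : {P Q R : RuleSet n} → P ≐ Q → Q ≐ R → P ≐ R
  ≐-trans P≐Q Q≐R r = (λ p → proj₁ (Q≐R r) (proj₁ (P≐Q r) p))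
                    , (λ q → proj₂ (P≐Q r) (proj₂ (Q≐R r) q))

  facts-injective : {I J : Subset n} → facts I ≐ facts J → I ≡ J
  facts-injective I≐J = ⊆-antisym
    (λ {x} x∈I → proj₂ (proj₁ (I≐J (fact x)) (refl , x∈I)))
    (λ {x} x∈J → proj₂ (proj₂ (I≐J (fact x)) (refl , x∈J)))

  x∈headS⁻ : (S : List (Rule n)) {x : Fin n} → x ∈ₛ headS S → ∃₂ λ s (_ : s ∈ S) → x ≡ hd s
  x∈headS⁻ []      x∈ = contradiction x∈ ∉⊥
  x∈headS⁻ (s ∷ S) x∈ with x∈p∪q⁻ (head s) (headS S) x∈
  ... | inj₁ x∈⁅s⁆ = s , here refl , x∈⁅y⁆⇒x≡y (hd s) x∈⁅s⁆
  ... | inj₂ x∈S  = let s′ , s′∈S , x≡ = x∈headS⁻ S x∈S in s′ , there s′∈S , x≡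

  x∈headS⁺ : {S : List (Rule n)} {s : Rule n} → s ∈ S → hd s ∈ₛ headS S
  x∈headS⁺ {s ∷ S} (here refl) = p⊆p∪q (headS S) (x∈⁅x⁆ (hd s))
  x∈headS⁺ {s ∷ S} (there s∈S) = q⊆p∪q (head s) (headS S) (x∈headS⁺ s∈S)

  bodyS-bodiless : (S : List (Rule n)) → All (λ s → body s ≡ ⊥) S → bodyS S ≡ ⊥
  bodyS-bodiless []      []           = refl
  bodyS-bodiless (s ∷ S) (b≡⊥ ∷ S⊥) = begin
    body s ∪ bodyS S ≡⟨ cong₂ _∪_ b≡⊥ (bodyS-bodiless S S⊥) ⟩
    ⊥ ∪ ⊥            ≡⟨ ∪-identityˡ ⊥ ⟩
    ⊥                ∎
    where open ≡-Reasoning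

  x∈T⁻ : (P : Theory n) (I : Subset n) {x : Fin n} → x ∈ₛ T P I →
         ∃₂ λ r (_ : r ∈ P) → body r ⊆ I × x ≡ hd r
  x∈T⁻ [] I x∈ = contradiction x∈ ∉⊥
  x∈T⁻ (r ∷ P) I x∈ with body r ⊆? I
  ... | no _ = let r′ , r′∈P , rest = x∈T⁻ P I x∈ in r′ , there r′∈P , rest
  ... | yes body⊆I with x∈p∪q⁻ (head r) (T P I) x∈
  ...   | inj₁ x∈⁅r⁆ = r , here refl , body⊆I , x∈⁅y⁆⇒x≡y (hd r) x∈⁅r⁆
  ...   | inj₂ x∈T  = let r′ , r′∈P , rest = x∈T⁻ P I x∈T in r′ , there r′∈P , rest

  x∈T⁺ : (P : Theory n) (I : Subset n) {r : Rule n} → r ∈ P → body r ⊆ I → hd r ∈ₛ T P I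
  x∈T⁺ (r′ ∷ P) I r∈P body⊆I with body r′ ⊆? I | r∈P
  ... | no  body⊈I | here refl = contradiction {A = body r′ ⊆ I} body⊆I body⊈I
  ... | no  _      | there r∈ = x∈T⁺ P I r∈ body⊆I
  ... | yes _      | here refl = p⊆p∪q (T P I) (x∈⁅x⁆ (hd r′))
  ... | yes _      | there r∈ = q⊆p∪q (head r′) (T P I) (x∈T⁺ P I r∈ body⊆I)

members : ∀ {n} → Subset n → List (Fin n)
members []            = []
members (inside  ∷ p) = zero ∷ map suc (members p)
members (outside ∷ p) = map suc (members p)

length-members : ∀ {n} (p : Subset n) → length (members p) ≡ ∣ p ∣
length-members []            = refl
length-members (inside  ∷ p) = cong suc (trans (length-map suc (members p)) (length-members p))
length-members (outside ∷ p) = trans (length-map suc (members p)) (length-members p)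

∈-members⁻ : ∀ {n} (p : Subset n) {x : Fin n} → x ∈ members p → x ∈ₛ p
∈-members⁻ (inside ∷ p) (here refl) = here
∈-members⁻ (inside ∷ p) (there x∈) with ∈-map⁻ suc x∈
... | _ , y∈ , refl = there (∈-members⁻ p y∈)
∈-members⁻ (outside ∷ p) x∈ with ∈-map⁻ suc x∈
... | _ , y∈ , refl = there (∈-members⁻ p y∈)

∈-members⁺ : ∀ {n} (p : Subset n) {x : Fin n} → x ∈ₛ p → x ∈ members p
∈-members⁺ (inside  ∷ p) here       = here refl
∈-members⁺ (inside  ∷ p) (there x∈) = there (∈-map⁺ suc (∈-members⁺ p x∈))
∈-members⁺ (outside ∷ p) (there x∈) = ∈-map⁺ suc (∈-members⁺ p x∈)

members-unique : ∀ {n} (p : Subset n) → Unique (members p)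
members-unique []            = []
members-unique (inside  ∷ p) = zero∉ (members p) ∷ Unique.map⁺ suc-injective (members-unique p)
  where
    zero∉ : ∀ {n} (xs : List (Fin n)) → All (zero ≢_) (map suc xs)
    zero∉ []       = []
    zero∉ (_ ∷ xs) = (λ ()) ∷ zero∉ xs
members-unique (outside ∷ p) = Unique.map⁺ suc-injective (members-unique p)

factsOf : ∀ {n} → Subset n → List (Rule n)
factsOf p = map fact (members p)

module _ {n : ℕ} where

  headS-factsOf : (p : Subset n) → headS (factsOf p) ≡ p
  headS-factsOf p = ⊆-antisym headS⊆p p⊆headS
    where
      headS⊆p : headS (factsOf p) ⊆ p
      headS⊆p x∈ with x∈headS⁻ (factsOf p) x∈
      ... | _ , s∈ , refl with ∈-map⁻ fact s∈
      ...   | _ , y∈ , refl = ∈-members⁻ p y∈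
      p⊆headS : p ⊆ headS (factsOf p)
      p⊆headS x∈ = x∈headS⁺ (∈-map⁺ fact (∈-members⁺ p x∈))

  factsOf-⊆ : {p I : Subset n} → p ⊆ I → All (facts I) (factsOf p)
  factsOf-⊆ {p} {I} p⊆I = All.tabulate λ s∈ → case (∈-map⁻ fact s∈)
    where
      case : ∀ {s} → ∃₂ (λ x (_ : x ∈ members p) → s ≡ fact x) → facts I s
      case (_ , x∈ , refl) = refl , p⊆I (∈-members⁻ p x∈)

  factsOf-⊆[_] : (r : Rule n) {I : Subset n} → body r ⊆ I → factsOf (body r) ⊆[ r ] facts I
  factsOf-⊆[ r ] body⊆I =
      factsOf-⊆ body⊆I
    , Unique.map⁺ (cong hd) (members-unique (body r))
    , trans (length-map fact (members (body r))) (length-members (body r))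

  facts-∘ : (I : Subset n) (R : RuleSet n) → (facts I ∘ᵗ R) ≐ facts I
  facts-∘ I R r′ = to , from
    where
      to : (facts I ∘ᵗ R) r′ → facts I r′
      to (r , (_ , a∈I) , [] , _ , _ , refl) = refl , a∈I
      to (r , (b≡⊥ , _) , _ ∷ _ , (_ , _ , |S|≡) , _ , _) =
        contradiction (trans |S|≡ (trans (cong ∣_∣ b≡⊥) (∣⊥∣≡0 n))) 1+n≢0
      from : facts I r′ → (facts I ∘ᵗ R) r′
      from (b≡⊥ , a∈I) =
        r′ , (b≡⊥ , a∈I) , [] ,
        ([] , [] , sym (trans (cong ∣_∣ b≡⊥) (∣⊥∣≡0 n))) , sym b≡⊥ , cong (hd r′ ←_) b≡⊥

  ∘-facts⁺ : (P : RuleSet n) (I : Subset n) {r : Rule n} → P r → body r ⊆ I →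
             (P ∘ᵗ facts I) (fact (hd r))
  ∘-facts⁺ P I {r} r∈P body⊆I =
    r , r∈P , factsOf (body r) , factsOf-⊆[ r ] body⊆I , headS-factsOf (body r) ,
    cong (hd r ←_) (sym (bodyS-bodiless (factsOf (body r)) (All.map proj₁ (factsOf-⊆ body⊆I))))

  ∘-facts⁻ : (P : RuleSet n) (I : Subset n) {r′ : Rule n} → (P ∘ᵗ facts I) r′ →
             ∃₂ λ r (_ : P r) → body r ⊆ I × r′ ≡ fact (hd r)
  ∘-facts⁻ P I (r , r∈P , S , (S⊆I , _) , headS≡body , refl) =
    r , r∈P , body⊆I , cong (hd r ←_) (bodyS-bodiless S (All.map proj₁ S⊆I))
    where
      body⊆I : body r ⊆ I
      body⊆I x∈ with x∈headS⁻ S (subst (_ ∈ₛ_) (sym headS≡body) x∈)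
      ... | _ , s∈S , refl = proj₂ (All.lookup S⊆I s∈S)

  ∘-facts≐T : (P : Theory n) (I : Subset n) → (⟦ P ⟧ ∘ᵗ facts I) ≐ facts (T P I)
  ∘-facts≐T P I r′ = to , from
    where
      to : (⟦ P ⟧ ∘ᵗ facts I) r′ → facts (T P I) r′
      to PI with ∘-facts⁻ ⟦ P ⟧ I PI
      ... | r , r∈P , body⊆I , refl = refl , x∈T⁺ P I r∈P body⊆I
      from : facts (T P I) r′ → (⟦ P ⟧ ∘ᵗ facts I) r′
      from (b≡⊥ , a∈T) with x∈T⁻ P I a∈T
      ... | r , r∈P , body⊆I , a≡ =
        subst (⟦ P ⟧ ∘ᵗ facts I) (sym r′≡) (∘-facts⁺ ⟦ P ⟧ I r∈P body⊆I)
        where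
          r′≡ : r′ ≡ fact (hd r)
          r′≡ = trans (cong (hd r′ ←_) b≡⊥) (cong fact a≡)

corollary3p5 : (n : ℕ) (P : Theory n) (I : Subset n) →
    (((⟦ P ⟧ ∘ᵗ facts I) ≐ (facts I ∘ᵗ ⟦ P ⟧)) → SupportedModel P I) ×
    (SupportedModel P I → ((⟦ P ⟧ ∘ᵗ facts I) ≐ (facts I ∘ᵗ ⟦ P ⟧)))
corollary3p5 n P I = commute⇒model , model⇒commute
  where
    commute⇒model : (⟦ P ⟧ ∘ᵗ facts I) ≐ (facts I ∘ᵗ ⟦ P ⟧) → SupportedModel P I
    commute⇒model PI≐IP =
      facts-injective (≐-trans (≐-sym (∘-facts≐T P I)) (≐-trans PI≐IP (facts-∘ I ⟦ P ⟧)))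
    model⇒commute : SupportedModel P I → (⟦ P ⟧ ∘ᵗ facts I) ≐ (facts I ∘ᵗ ⟦ P ⟧)
    model⇒commute TI≡I =
      ≐-trans (∘-facts≐T P I) (≐-trans (≐-reflexive (cong facts TI≡I)) (≐-sym (facts-∘ I ⟦ P ⟧)))
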